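{- Let $\tau=\{E\}\subseteq\sigma$ with $\sigma$ a finite relational signature, and let $p(\bar x)$ be a closure type over $\sigma$, where $\bar x=(x_1,\ldots,x_k)$. (i) For all distinct $i,j\in\{1,\ldots,k\}$, either $p(\bar x)\models_{tree}$ "$x_j$ is an ancestor of $x_i$", or $p(\bar x)\models_{tree}$ "$x_j$ is not an ancestor of $x_i$". (ii) For every subsequence $\bar y$ of $\bar x$ and every $x_i\in\mathrm{rng}(\bar x)\setminus\mathrm{rng}(\bar y)$, either $p(\bar x)\models_{tree}x_i\in\mathrm{cl}(\bar y)$, or $p(\bar x)\models_{tree}x_i\notin\mathrm{cl}(\bar y)$.
   Context: A tree is a finite $\tau$-structure ($\tau=\{E\}$, $E$ binary) with $E$ irreflexive and asymmetric, a unique root (no $E$-predecessor), a unique parent for each non-root vertex, and no directed $E$-cycles; $a$ is an ancestor of $b$ if there is a directed $E$-path of length $\ge1$ from $a$ to $b$. A fixed $\Delta\in\mathbb{N}^+$ bounds the height of all trees. $\mathrm{cl}(B)$ is $B$ together with the root and all ancestors of members of $B$; $B$ is closed if $\mathrm{cl}(B)=B$; "$\{z_1,\ldots,z_l\}$ is closed" is the formula $\forall z((\bigvee_iE(z,z_i))\to\bigvee_iz=z_i)$, and "$x\in\mathrm{cl}(\bar y)$" and "$x$ is an ancestor of $y$" are first-order expressible (given height $\le\Delta$). $\varphi\models_{tree}\psi$ means every $\sigma$-structure expanding a tree (of height $\le\Delta$) and every tuple satisfying $\varphi$ satisfies $\psi$. An atomic type over $\sigma$ is a conjunction $\varphi(x_1,\ldots,x_k)$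 of $\sigma$-literals containing $E(x_i,x_j)$ or $\neg E(x_i,x_j)$ for all $i,j$ and $x_i\ne x_j$ for all distinct $i,j$, satisfiable in some $\sigma$-structure expanding a tree. A closure type over $\sigma$ is a formula equivalent to $\exists y_1\ldots y_m(\varphi(\bar x,\bar y)\wedge\text{``}\{\bar x,\bar y\}\text{ is closed''})$ with $\varphi$ an atomic type over $\sigma$ and $\varphi\models y_i\in\mathrm{cl}(\bar x)$ for all $i$ ($m=0$ allowed; if $\bar x$ is empty then $m=1$ and $y_1$ is the root). -}

module Defs where

open import Data.Nat using (ℕ; zero; suc; _+_; _<_)
open import Data.Fin using (Fin; _≟_; _↑ˡ_; _↑ʳ_)
open import Data.Bool using (Bool; true; false)
open import Data.Vec using (Vec)
import Data.Vec as V
open import Data.Vec.Functional using (_++_)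
open import Data.List using (List)
open import Data.List.Membership.Propositional using (_∈_)
open import Data.List.Relation.Unary.All using (All)
open import Data.Product using (Σ; ∃; _×_; _,_)
open import Data.Sum using (_⊎_)
open import Relation.Nullary using (¬_)
open import Relation.Nullary.Decidable using (isYes)
open import Relation.Binary.PropositionalEquality using (_≡_; _≢_)
open import Function using (_∘_)

-- A finite relational signature σ ⊇ τ = {E}:  σ = {E} ∪ {R₀,…,R_{s-1}},
-- where E is binary and Rᵢ has arity (ar i).
record Sig : Set where
  field
    s  : ℕ
    ar : Fin s → ℕ

record Struct (σ : Sig) : Set where
  field
    n   : ℕ
    E   : Fin n → Fin n → Bool
    rel : (R : Fin (Sig.s σ)) → Vec (Fin n) (Sig.ar σ R) → Bool

module _ {σ : Sig} (M : Struct σ) where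
  open Struct M

  Edge : Fin n → Fin n → Set
  Edge a b = E a b ≡ true

  data Path : Fin n → Fin n → ℕ → Set where
    here : ∀ {a} → Path a a zero
    step : ∀ {a b c l} → Edge a b → Path b c l → Path a c (suc l)

  Ancestor : Fin n → Fin n → Set
  Ancestor a b = ∃ λ l → Path a b (suc l)

  NoPred : Fin n → Set
  NoPred r = ∀ a → ¬ Edge a r

  IsTree : ℕ → Set
  IsTree Δ =
      (∀ a → ¬ Edge a a)
    × (∀ a b → Edge a b → ¬ Edge b a)
    × (Σ (Fin n) λ r → NoPred r × (∀ r' → NoPred r' → r' ≡ r))
    × (∀ b a a' → Edge a b → Edge a' b → a ≡ a')
    × (∀ a → ¬ Ancestor a a)
    × (∀ a b → ¬ Path a b (suc Δ))

  InCl : ∀ {l} → Fin n → (Fin l → Fin n) → Set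
  InCl x B = NoPred x ⊎ (∃ λ i → x ≡ B i ⊎ Ancestor x (B i))

  IsClosed : ∀ {l} → (Fin l → Fin n) → Set
  IsClosed z = ∀ w → (∃ λ i → Edge w (z i)) → ∃ λ i → w ≡ z i

record TreeStr (Δ : ℕ) (σ : Sig) : Set where
  field
    str    : Struct σ
    isTree : IsTree str Δ
open TreeStr public

-- σ-literals in variables Fin v (Bool = polarity: true positive, false negated)
data Literal (σ : Sig) (v : ℕ) : Set where
  eqLit  : Fin v → Fin v → Bool → Literal σ v
  ELit   : Fin v → Fin v → Bool → Literal σ v
  relLit : (R : Fin (Sig.s σ)) → Vec (Fin v) (Sig.ar σ R) → Bool → Literal σ v

module _ {σ : Sig} (M : Struct σ) where
  open Struct M
  SatLit : ∀ {v} → (Fin v → Fin n) → Literal σ v → Set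
  SatLit a (eqLit i j b)  = isYes (a i ≟ a j) ≡ b
  SatLit a (ELit i j b)   = E (a i) (a j) ≡ b
  SatLit a (relLit R t b) = rel R (V.map a t) ≡ b

  Sat : ∀ {v} → List (Literal σ v) → (Fin v → Fin n) → Set
  Sat φ a = All (SatLit a) φ

record IsAtomicType (Δ : ℕ) (σ : Sig) {v : ℕ} (φ : List (Literal σ v)) : Set where
  field
    hasE    : ∀ i j → ∃ λ b → ELit i j b ∈ φ
    hasNeq  : ∀ i j → i ≢ j → eqLit i j false ∈ φ
    satisf  : Σ (TreeStr Δ σ) λ M → Σ (Fin v → Fin (Struct.n (str M))) λ a → Sat (str M) φ a

-- closure type p(x₁,…,x_k) ≡ ∃ y₁…y_m (φ(x̄,ȳ) ∧ "{x̄,ȳ} is closed")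
record ClosureType (Δ : ℕ) (σ : Sig) (k : ℕ) : Set where
  field
    m       : ℕ
    φ       : List (Literal σ (k + m))
    atomic  : IsAtomicType Δ σ φ
    ysInCl  : ∀ (i : Fin m) (M : TreeStr Δ σ) (a : Fin (k + m) → Fin (Struct.n (str M)))
              → Sat (str M) φ a → InCl (str M) (a (k ↑ʳ i)) (a ∘ (_↑ˡ m))
    -- if x̄ is empty then m = 1 (and y₁ is the root, forced by ysInCl)
    emptyCase : k ≡ 0 → m ≡ 1

module _ {Δ : ℕ} {σ : Sig} {k : ℕ} (p : ClosureType Δ σ k) where
  open ClosureType p
  SatCT : (M : TreeStr Δ σ) → (Fin k → Fin (Struct.n (str M))) → Set
  SatCT M x = Σ (Fin m → Fin (Struct.n (str M))) λ y →
                Sat (str M) φ (x ++ y) × IsClosed (str M) (x ++ y)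

  Entails : ((M : TreeStr Δ σ) → (Fin k → Fin (Struct.n (str M))) → Set) → Set
  Entails ψ = ∀ (M : TreeStr Δ σ) (x : Fin k → Fin (Struct.n (str M))) → SatCT M x → ψ M x

-- ι : Fin l → Fin k strictly increasing, i.e. (x_{ι 0},…) is a subsequence of x̄
StrictlyIncreasing : ∀ {l k} → (Fin l → Fin k) → Set
StrictlyIncreasing {l} ι = ∀ (s t : Fin l) → Data.Fin._<_ s t → Data.Fin._<_ (ι s) (ι t)

-- If x̄ȳ witnesses p, then {x̄ȳ} is closed and φ fixes both the E-pattern
-- of x̄ȳ and the distinctness of its entries. Closedness pulls every E-path
-- ending inside x̄ȳ back to a path of that pattern, so ancestry and rootness
-- among the xᵢ are the same in every model of p: they are read off φ. The
-- height bound makes that reading a finite search, hence decidable, and a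
-- decidable condition that is equivalent to ψ in every model of p yields
-- p ⊨ ψ or p ⊨ ¬ψ.
module Submission where

open import Defs
open import Data.Nat using (ℕ)
open import Data.Fin using (Fin)
open import Data.Product using (_×_)
open import Data.Sum using (_⊎_)
open import Relation.Nullary using (¬_)
open import Relation.Binary.PropositionalEquality using (_≢_)
open import Function using (_∘_)

open import Data.Nat using (zero; suc; _≤_; s≤s; _≤?_)
open import Data.Nat.Properties using (≰⇒>)
open import Data.Fin using (toℕ; fromℕ<; _↑ˡ_; _≟_)
open import Data.Fin.Properties using (any?; all?; ↑ˡ-injective; toℕ-fromℕ<)
open import Data.Bool using (true; false)
open import Data.Bool.Properties using () renaming (_≟_ to _≟ᵇ_)
open import Data.List using (List)
open import Data.List.Relation.Unary.All using (lookup)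
open import Data.Product using (∃; _,_; proj₁; proj₂; map₂)
open import Data.Sum using (inj₁; inj₂)
import Data.Sum as Sum
open import Data.Sum.Function.Propositional using (_⊎-⇔_)
open import Data.Vec.Functional using (_++_)
open import Data.Vec.Functional.Properties using (lookup-++ˡ)
open import Function.Bundles using (_⇔_; mk⇔; Equivalence)
open import Function.Definitions using (Injective)
open import Function.Properties.Equivalence using () renaming (trans to ⇔-trans)
open import Relation.Nullary using (Dec; yes; no; ¬?; contradiction)
open import Relation.Nullary.Decidable using (map′; _×-dec_; _⊎-dec_; isYes)
open import Relation.Binary.PropositionalEquality using (_≡_; refl; sym; trans; subst; subst₂)

module _ {σ : Sig} (M : Struct σ) where
  open Struct M

  AncestorWithin : ℕ → Fin n → Fin n → Set
  AncestorWithin h a b = ∃ λ (l : Fin h) → Path M a b (suc (toℕ l))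

  edge? : ∀ a b → Dec (Edge M a b)
  edge? a b = E a b ≟ᵇ true

  noPred? : ∀ a → Dec (NoPred M a)
  noPred? a = all? λ b → ¬? (edge? b a)

  path? : ∀ a b l → Dec (Path M a b l)
  path? a b zero = map′ (λ { refl → here }) (λ { here → refl }) (a ≟ b)
  path? a b (suc l) =
    map′ (λ (c , e , π) → step e π) (λ { (step e π) → _ , e , π })
         (any? λ c → edge? a c ×-dec path? c b l)

  ancestorWithin? : ∀ h a b → Dec (AncestorWithin h a b)
  ancestorWithin? h a b = any? λ l → path? a b (suc (toℕ l))

  take-path : ∀ {a c l} → Path M a c l → ∀ q → q ≤ l → ∃ λ b → Path M a b q
  take-path π          zero    _         = _ , here
  take-path (step e π) (suc q) (s≤s q≤l) = map₂ (step e) (take-path π q q≤l)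

  module _ {h : ℕ} (height≤h : ∀ a b → ¬ Path M a b (suc h)) where

    path-length≤ : ∀ {a b l} → Path M a b l → l ≤ h
    path-length≤ {l = l} π with l ≤? h
    ... | yes l≤h = l≤h
    ... | no  l≰h = contradiction (proj₂ (take-path π (suc h) (≰⇒> l≰h))) (height≤h _ _)

    ancestor⇔ancestorWithin : ∀ {a b} → Ancestor M a b ⇔ AncestorWithin h a b
    ancestor⇔ancestorWithin {a} {b} = mk⇔ bound (λ (l , π) → toℕ l , π)
      where
      bound : Ancestor M a b → AncestorWithin h a b
      bound (l , π) = fromℕ< lt , subst (λ q → Path M a b (suc q)) (sym (toℕ-fromℕ< lt)) π
        where lt = path-length≤ π

  inCl⇔ : ∀ {l c} {B : Fin l → Fin n} → (∀ t → c ≢ B t) →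
          InCl M c B ⇔ (NoPred M c ⊎ ∃ λ t → Ancestor M c (B t))
  inCl⇔ {c = c} {B} c∉B = mk⇔ to (Sum.map₂ (map₂ inj₂))
    where
    to : InCl M c B → NoPred M c ⊎ ∃ λ t → Ancestor M c (B t)
    to (inj₁ root)            = inj₁ root
    to (inj₂ (t , inj₁ c≡Bt)) = contradiction c≡Bt (c∉B t)
    to (inj₂ (t , inj₂ c<Bt)) = inj₂ (t , c<Bt)

module _ {σ σ′ : Sig} {G : Struct σ′} {N : Struct σ}
         (f : Fin (Struct.n G) → Fin (Struct.n N))
         (f-E : ∀ u w → Struct.E N (f u) (f w) ≡ Struct.E G u w)
         (closed : IsClosed N f) where

  map-path : ∀ {u w l} → Path G u w l → Path N (f u) (f w) l
  map-path here       = here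
  map-path (step e π) = step (trans (f-E _ _) e) (map-path π)

  -- Induction from the end of the path: each new vertex is the parent of
  -- one already in the image, so closedness puts it in the image too.
  lift-path : ∀ {a w l} → Path N a (f w) l → ∃ λ u → a ≡ f u × Path G u w l
  lift-path here = _ , refl , here
  lift-path (step {a} e π) with lift-path π
  ... | u′ , refl , π′ with closed a (u′ , e)
  ... | u , refl = u , refl , step (trans (sym (f-E u u′)) e) π′

  noPred⇔ : ∀ {u} → NoPred N (f u) ⇔ NoPred G u
  noPred⇔ {u} = mk⇔ (λ root w e → root (f w) (trans (f-E w u) e)) reflect
    where
    reflect : NoPred G u → NoPred N (f u)
    reflect root a e with closed a (u , e)
    ... | w , refl = root w (trans (sym (f-E w u)) e)

  module _ (f-injective : Injective _≡_ _≡_ f) where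

    path⇔ : ∀ {u w l} → Path N (f u) (f w) l ⇔ Path G u w l
    path⇔ = mk⇔ reflect map-path
      where
      reflect : ∀ {u w l} → Path N (f u) (f w) l → Path G u w l
      reflect π with lift-path π
      ... | _ , fu≡fu′ , π′ with f-injective fu≡fu′
      ... | refl = π′

    ancestorWithin⇔ : ∀ {h u w} → AncestorWithin N h (f u) (f w) ⇔ AncestorWithin G h u w
    ancestorWithin⇔ = mk⇔ (map₂ (Equivalence.to path⇔)) (map₂ (Equivalence.from path⇔))

τ : Sig
τ = record { s = 0 ; ar = λ () }

module _ {Δ : ℕ} {σ : Sig} {v : ℕ} {φ : List (Literal σ v)} (φ-atomic : IsAtomicType Δ σ φ) where
  open IsAtomicType φ-atomic

  E-pattern : Struct τ
  E-pattern = record { n = v ; E = λ u w → proj₁ (hasE u w) ; rel = λ () }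

  module _ {N : Struct σ} {z : Fin v → Fin (Struct.n N)} (z⊨φ : Sat N φ z) where

    sat⇒preserves-E : ∀ u w → Struct.E N (z u) (z w) ≡ Struct.E E-pattern u w
    sat⇒preserves-E u w = lookup z⊨φ (proj₂ (hasE u w))

    sat⇒injective : Injective _≡_ _≡_ z
    sat⇒injective {u} {w} zu≡zw with u ≟ w
    ... | yes u≡w = u≡w
    ... | no  u≢w = contradiction zu≡zw (refuted (z u ≟ z w) (lookup z⊨φ (hasNeq u w u≢w)))
      where
      refuted : ∀ {A : Set} (a? : Dec A) → isYes a? ≡ false → ¬ A
      refuted (yes _)  ()
      refuted (no  ¬a) _ = ¬a

module _ {Δ : ℕ} {σ : Sig} {k : ℕ} (p : ClosureType Δ σ k) (M : TreeStr Δ σ)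
         {x : Fin k → Fin (Struct.n (str M))} {y : Fin (ClosureType.m p) → Fin (Struct.n (str M))}
         (x++y⊨φ : Sat (str M) (ClosureType.φ p) (x ++ y)) (closed : IsClosed (str M) (x ++ y)) where
  open ClosureType p

  private
    G : Struct τ
    G = E-pattern atomic

    z-E : ∀ u w → Struct.E (str M) ((x ++ y) u) ((x ++ y) w) ≡ Struct.E G u w
    z-E = sat⇒preserves-E atomic x++y⊨φ

    z-injective : Injective _≡_ _≡_ (x ++ y)
    z-injective = sat⇒injective atomic x++y⊨φ

    height≤Δ : ∀ a b → ¬ Path (str M) a b (suc Δ)
    height≤Δ = proj₂ (proj₂ (proj₂ (proj₂ (proj₂ (isTree M)))))

  x-injective : Injective _≡_ _≡_ x
  x-injective {i} {j} xi≡xj = ↑ˡ-injective m i j (z-injective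
    (trans (lookup-++ˡ x y i) (trans xi≡xj (sym (lookup-++ˡ x y j)))))

  ancestor⇔pattern : ∀ i j → Ancestor (str M) (x i) (x j) ⇔ AncestorWithin G Δ (i ↑ˡ m) (j ↑ˡ m)
  ancestor⇔pattern i j =
    subst₂ (λ a b → Ancestor (str M) a b ⇔ AncestorWithin G Δ (i ↑ˡ m) (j ↑ˡ m))
           (lookup-++ˡ x y i) (lookup-++ˡ x y j)
           (⇔-trans (ancestor⇔ancestorWithin (str M) height≤Δ)
                    (ancestorWithin⇔ (x ++ y) z-E closed z-injective))

  noPred⇔pattern : ∀ i → NoPred (str M) (x i) ⇔ NoPred G (i ↑ˡ m)
  noPred⇔pattern i =
    subst (λ a → NoPred (str M) a ⇔ NoPred G (i ↑ˡ m)) (lookup-++ˡ x y i)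
          (noPred⇔ {G = G} {N = str M} (x ++ y) z-E closed)

  inCl⇔pattern : ∀ {l} (ι : Fin l → Fin k) i → (∀ t → ι t ≢ i) →
                 InCl (str M) (x i) (x ∘ ι)
                 ⇔ (NoPred G (i ↑ˡ m) ⊎ ∃ λ t → AncestorWithin G Δ (i ↑ˡ m) (ι t ↑ˡ m))
  inCl⇔pattern ι i ι∌i =
    ⇔-trans (inCl⇔ (str M) λ t xi≡xιt → ι∌i t (sym (x-injective xi≡xιt)))
            (noPred⇔pattern i ⊎-⇔ mk⇔ (map₂ (Equivalence.to (ancestor⇔pattern i _)))
                                      (map₂ (Equivalence.from (ancestor⇔pattern i _))))

entails-dichotomy : ∀ {Δ σ k} (p : ClosureType Δ σ k)
  (ψ : (M : TreeStr Δ σ) → (Fin k → Fin (Struct.n (str M))) → Set) {C : Set} → Dec C →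
  (∀ M x → SatCT p M x → ψ M x ⇔ C) → Entails p ψ ⊎ Entails p (λ M x → ¬ ψ M x)
entails-dichotomy p ψ (yes c) ψ⇔C = inj₁ λ M x x⊨p → Equivalence.from (ψ⇔C M x x⊨p) c
entails-dichotomy p ψ (no ¬c) ψ⇔C = inj₂ λ M x x⊨p → ¬c ∘ Equivalence.to (ψ⇔C M x x⊨p)

lemma5p13 : (Δ : ℕ) → (σ : Sig) → (k : ℕ) → (p : ClosureType Δ σ k) →
    ((i j : Fin k) → i ≢ j →
        Entails p (λ M x → Ancestor (str M) (x j) (x i))
      ⊎ Entails p (λ M x → ¬ Ancestor (str M) (x j) (x i)))
    ×
    ((l : ℕ) (ι : Fin l → Fin k) → StrictlyIncreasing ι →
     (i : Fin k) → (∀ t → ι t ≢ i) →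
        Entails p (λ M x → InCl (str M) (x i) (x ∘ ι))
      ⊎ Entails p (λ M x → ¬ InCl (str M) (x i) (x ∘ ι)))
lemma5p13 Δ σ k p =
    (λ i j _ → entails-dichotomy p _ (ancestorWithin? G Δ (j ↑ˡ m) (i ↑ˡ m))
       λ M x (y , sat , closed) → ancestor⇔pattern p M sat closed j i)
  , (λ l ι _ i ι∌i → entails-dichotomy p _
       (noPred? G (i ↑ˡ m) ⊎-dec any? λ t → ancestorWithin? G Δ (i ↑ˡ m) (ι t ↑ˡ m))
       λ M x (y , sat , closed) → inCl⇔pattern p M sat closed ι i ι∌i)
  where
  open ClosureType p

  G : Struct τ
  G = E-pattern atomic
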